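{- Let $m\geq 1$, let $G''\in\mathcal{A}\cup(\mathcal{A}\bowtie K_1)$, let $G'=G''\bowtie K_m$, and let $G$ be the graph obtained from $G'$ by attaching a new leaf to each vertex of the clique $K_m$. If $G$ has order $n\geq 3$, then $\gamma_t^{\mathrm{ID}}(G)\geq n-1$.
   Context: All graphs are finite, simple and undirected. $N[v]$ is the closed neighbourhood of $v$; for $C\subseteq V(G)$, $I(v)=N[v]\cap C$. A total dominating identifying code of $G$ is a set $C$ with $I(u)\neq I(v)$ for all distinct vertices $u,v$ and such that every vertex has a neighbour in $C$; $\gamma_t^{\mathrm{ID}}(G)$ is the minimum size of such a code. For $k\geq 0$, $A_k$ is the graph on $x_1,\dots,x_{2k}$ with $x_ix_j$ an edge iff $i\neq j$ and $|i-j|\leq k-1$ ($A_0$ is the empty graph). $G\bowtie H$ denotes the complete join of $G$ and $H$ (disjoint union plus all edges between them). $\mathcal{A}$ is the set of graphs obtained by taking any number (possibly zero) of disjoint copies of graphs from $\{A_k\mid k\geq 1\}$ and joining every pair of these copies by all possible edges; $\mathcal{A}\bowtie K_1=\{H\bowtie K_1\mid H\in\mathcal{A}\}$. -}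

module Defs where

open import Data.Nat using (ℕ; zero; suc; _+_; _∸_; _≤ᵇ_; _≡ᵇ_; ∣_-_∣)
open import Data.Bool using (Bool; true; false; not; _∧_; _∨_; if_then_else_)
open import Data.Fin using (Fin; toℕ; splitAt)
open import Data.Fin.Subset using (Subset; _∈_; _∩_)
open import Data.Vec using (tabulate)
open import Data.Sum using (inj₁; inj₂)
open import Data.List using (List; []; _∷_)
open import Data.Product using (∃; _×_)
open import Relation.Binary.PropositionalEquality using (_≡_; _≢_)

record Graph : Set where
  constructor mkGraph
  field
    order : ℕ
    adj   : Fin order → Fin order → Bool
open Graph public

_=ᶠ_ : ∀ {n} → Fin n → Fin n → Bool
i =ᶠ j = toℕ i ≡ᵇ toℕ j

emptyGraph : Graph
emptyGraph = mkGraph 0 (λ _ _ → false)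

K : ℕ → Graph
K m = mkGraph m (λ i j → not (i =ᶠ j))

-- A_k : vertices x_1..x_{2k} (here 0..2k-1), x_i x_j edge iff i ≠ j and |i-j| ≤ k-1
A : ℕ → Graph
A k = mkGraph (k + k) (λ i j → not (i =ᶠ j) ∧ (∣ toℕ i - toℕ j ∣ ≤ᵇ (k ∸ 1)))

_⋈_ : Graph → Graph → Graph
G ⋈ H = mkGraph (order G + order H) adj'
  where
  adj' : Fin (order G + order H) → Fin (order G + order H) → Bool
  adj' x y with splitAt (order G) x | splitAt (order G) y
  ... | inj₁ a | inj₁ b = adj G a b
  ... | inj₂ a | inj₂ b = adj H a b
  ... | inj₁ _ | inj₂ _ = true
  ... | inj₂ _ | inj₁ _ = true

joinA : List ℕ → Graph
joinA []       = emptyGraph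
joinA (k ∷ ks) = A k ⋈ joinA ks

-- Given G'' with p vertices, G' = G'' ⋈ K_m has vertices 0..p+m-1, the clique being
-- p..p+m-1; attach a new leaf (vertex p+m+j) to each clique vertex p+j.
attachLeaves : (p m : ℕ) → (Fin (p + m) → Fin (p + m) → Bool) → Graph
attachLeaves p m a = mkGraph ((p + m) + m) adj'
  where
  adj' : Fin ((p + m) + m) → Fin ((p + m) + m) → Bool
  adj' x y with splitAt (p + m) x | splitAt (p + m) y
  ... | inj₁ u | inj₁ v = a u v
  ... | inj₁ u | inj₂ j = toℕ u ≡ᵇ (p + toℕ j)
  ... | inj₂ j | inj₁ u = toℕ u ≡ᵇ (p + toℕ j)
  ... | inj₂ _ | inj₂ _ = false

-- G'' = joinA ks (member of 𝒜) or joinA ks ⋈ K_1 (member of 𝒜 ⋈ K_1) according to b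
G'' : List ℕ → Bool → Graph
G'' ks b = if b then joinA ks ⋈ K 1 else joinA ks

theGraph : (m : ℕ) → List ℕ → Bool → Graph
theGraph m ks b = attachLeaves (order (G'' ks b)) m (adj (G'' ks b ⋈ K m))

N[_]of_ : ∀ {n} → Fin n → (Fin n → Fin n → Bool) → Subset n
N[ v ]of a = tabulate (λ w → (v =ᶠ w) ∨ a v w)

IsTDIDCode : (G : Graph) → Subset (order G) → Set
IsTDIDCode G C =
  ((u v : Fin (order G)) → u ≢ v → (N[ u ]of adj G ∩ C) ≢ (N[ v ]of adj G ∩ C))
  × ((v : Fin (order G)) → ∃ λ w → adj G v w ≡ true × w ∈ C)

{-# OPTIONS --safe #-}
-- Fix a reference set R of vertices and call w pinned if some closed neighbourhood N[p]
-- agrees with R off w and either differs from R at w or is N[w] itself. Two distinct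
-- pinned vertices outside a code C would give witnesses with equal traces on C, which
-- must then coincide, a contradiction; so at most one vertex is both pinned and outside C.
-- Every other vertex lies in every code: it is the sole separator of two closed
-- neighbourhoods, or the sole neighbour of some vertex. In G, with R the non-leaves, each
-- vertex is of one of these kinds: in A_k every vertex separates two consecutive vertices
-- alone or is pinned by a vertex adjacent to all others, which survives joins; a clique
-- vertex is the sole neighbour of its leaf, and that leaf is pinned by the clique vertex.
module Submission where

open import Defs
open import Data.Bool using (Bool; true; false; not; _∨_)
open import Data.Bool.Properties using (T-≡; ⇔→≡; ¬-not; not-¬; ∨-zeroʳ; ∨-inverseʳ)
open import Data.Fin using (Fin; toℕ; splitAt; _↑ˡ_; _↑ʳ_; fromℕ<)
open import Data.Fin.Properties
  using (_≟_; toℕ-injective; suc-injective; toℕ<n; toℕ-↑ʳ; toℕ-fromℕ<; splitAt-↑ˡ; splitAt-↑ʳ;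
         splitAt⁻¹-↑ˡ; splitAt⁻¹-↑ʳ; ↑ˡ-injective; ↑ʳ-injective)
open import Data.Fin.Subset using (Subset; ∣_∣; _∩_; _∈_; _∉_; _⊆_; ∁; ⁅_⁆)
open import Data.Fin.Subset.Properties
  using (_∈?_; ∩⇔×; ⊆-antisym; nonempty?; Empty-unique; ∣⊥∣≡0; ∣⁅x⁆∣≡1; x∈⁅y⁆⇔x≡y;
         p⊆q⇒∣p∣≤∣q∣; ∣∁p∣≡n∸∣p∣; x∈∁p⇒x∉p)
open import Data.Nat using (ℕ; zero; suc; _+_; _∸_; _≤_; _<_; z≤n; s≤s; s≤s⁻¹; _≤ᵇ_; ∣_-_∣; _<?_)
open import Data.Nat.Properties
  using (≡ᵇ⇒≡; ≡⇒≡ᵇ; ≤ᵇ⇒≤; ≤⇒≤ᵇ; ≤-trans; ≤-reflexive; ≤-antisym; module ≤-Reasoning;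
         +-comm; +-suc; +-monoˡ-≤; +-cancelʳ-≡; m≤m+n; m≤n+m; m≤n⇒m≤1+n; n≤1+n; n<1+n;
         <⇒≤; <⇒≢; ≤∧≢⇒<; ≮⇒≥; ≤-<-trans; <-≤-trans; 1+n≰n;
         m≤n+o⇒m∸n≤o; m≤n+m∸n; m∸n+n≡m; ∣n-n∣≡0)
open import Data.Vec.Properties using (lookup∘tabulate; []=⇒lookup; lookup⇒[]=)
open import Data.List using (List; []; _∷_)
open import Data.List.Relation.Unary.All using (All; []; _∷_)
open import Data.Product using (Σ; ∃; _×_; _,_; proj₁; proj₂)
open import Data.Sum using (_⊎_; inj₁; inj₂; [_,_])
open import Function using (_∘_; const)
open import Function.Bundles using (_⇔_; mk⇔; Equivalence)
open import Function.Definitions using (Injective)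
open import Relation.Nullary using (¬_; yes; no; contradiction)
open import Relation.Nullary.Decidable using (decidable-stable)
open import Relation.Binary.PropositionalEquality
  using (_≡_; _≢_; refl; sym; trans; cong; subst; module ≡-Reasoning)

open Equivalence using (to; from)

=ᶠ⇔≡ : ∀ {n} {i j : Fin n} → (i =ᶠ j) ≡ true ⇔ i ≡ j
=ᶠ⇔≡ {i = i} {j} = mk⇔
  (λ e → toℕ-injective (≡ᵇ⇒≡ (toℕ i) (toℕ j) (from T-≡ e)))
  (λ { refl → to T-≡ (≡⇒≡ᵇ (toℕ i) (toℕ i) refl) })

=ᶠ-refl : ∀ {n} (i : Fin n) → (i =ᶠ i) ≡ true
=ᶠ-refl i = from (=ᶠ⇔≡ {i = i}) refl

=ᶠ-≢ : ∀ {n} {i j : Fin n} → i ≢ j → (i =ᶠ j) ≡ false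
=ᶠ-≢ i≢j = ¬-not (i≢j ∘ to =ᶠ⇔≡)

=ᶠ-injective : ∀ {m n} (f : Fin m → Fin n) → Injective _≡_ _≡_ f →
               ∀ i j → (f i =ᶠ f j) ≡ (i =ᶠ j)
=ᶠ-injective f f-inj i j =
  ⇔→≡ (mk⇔ (from =ᶠ⇔≡ ∘ f-inj ∘ to =ᶠ⇔≡) (from =ᶠ⇔≡ ∘ cong f ∘ to =ᶠ⇔≡))

↑ˡ≢↑ʳ : ∀ {a b} (u : Fin a) (j : Fin b) → u ↑ˡ b ≢ a ↑ʳ j
↑ˡ≢↑ʳ Fin.zero    j ()
↑ˡ≢↑ʳ (Fin.suc u) j e = ↑ˡ≢↑ʳ u j (suc-injective e)

∉-unique⇒n∸1≤∣p∣ : ∀ {n} (p : Subset n) → (∀ {x y} → x ∉ p → y ∉ p → x ≡ y) → n ∸ 1 ≤ ∣ p ∣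
∉-unique⇒n∸1≤∣p∣ {n} p ∉-unique = m≤n+o⇒m∸n≤o n 1 (begin
    n                  ≤⟨ m≤n+m∸n n ∣ p ∣ ⟩
    ∣ p ∣ + (n ∸ ∣ p ∣) ≡⟨ +-comm ∣ p ∣ _ ⟩
    (n ∸ ∣ p ∣) + ∣ p ∣ ≤⟨ +-monoˡ-≤ ∣ p ∣ (subst (_≤ 1) (∣∁p∣≡n∸∣p∣ p) ∣∁p∣≤1) ⟩
    1 + ∣ p ∣           ∎)
  where
  open ≤-Reasoning
  ∣∁p∣≤1 : ∣ ∁ p ∣ ≤ 1
  ∣∁p∣≤1 with nonempty? (∁ p)
  ... | yes (x , x∈∁p) = begin
    ∣ ∁ p ∣   ≤⟨ p⊆q⇒∣p∣≤∣q∣ (λ y∈∁p → from x∈⁅y⁆⇔x≡y (∉-unique (x∈∁p⇒x∉p y∈∁p) (x∈∁p⇒x∉p x∈∁p))) ⟩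
    ∣ ⁅ x ⁆ ∣ ≡⟨ ∣⁅x⁆∣≡1 x ⟩
    1         ∎
  ... | no ∁p-empty = subst (_≤ 1) (sym (trans (cong ∣_∣ (Empty-unique ∁p-empty)) (∣⊥∣≡0 n))) z≤n

Nbr : (G : Graph) → Fin (order G) → Fin (order G) → Bool
Nbr G p x = (p =ᶠ x) ∨ adj G p x

∈N[]⇔ : ∀ (G : Graph) p {x} → x ∈ N[ p ]of adj G ⇔ Nbr G p x ≡ true
∈N[]⇔ G p {x} = mk⇔
  (λ x∈N → trans (sym (lookup∘tabulate (Nbr G p) x)) ([]=⇒lookup x∈N))
  (λ e → lookup⇒[]= x _ (trans (lookup∘tabulate (Nbr G p) x) e))

AgreeOff : ∀ {n} → (Fin n → Bool) → (Fin n → Bool) → Fin n → Set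
AgreeOff f g w = ∀ x → x ≢ w → f x ≡ g x

SoleSeparator : (G : Graph) → Fin (order G) → Set
SoleSeparator G w = Σ (Fin (order G)) λ p → Σ (Fin (order G)) λ q →
  p ≢ q × AgreeOff (Nbr G p) (Nbr G q) w

SoleNeighbour : (G : Graph) → Fin (order G) → Set
SoleNeighbour G w = Σ (Fin (order G)) λ v → ∀ y → adj G v y ≡ true → y ≡ w

Pinned : (G : Graph) → (Fin (order G) → Bool) → Fin (order G) → Set
Pinned G R w = Σ (Fin (order G)) λ p → AgreeOff (Nbr G p) R w × (Nbr G p w ≡ not (R w) ⊎ p ≡ w)

module _ {G : Graph} {C : Subset (order G)} (code : IsTDIDCode G C) where

  identifies : ∀ {p q} → (∀ x → x ∈ C → Nbr G p x ≡ Nbr G q x) → p ≡ q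
  identifies {p} {q} agree = decidable-stable (p ≟ q) λ p≢q →
    proj₁ code p q p≢q (⊆-antisym (restrict agree) (restrict (λ x x∈C → sym (agree x x∈C))))
    where
    restrict : ∀ {p q} → (∀ x → x ∈ C → Nbr G p x ≡ Nbr G q x) →
               N[ p ]of adj G ∩ C ⊆ N[ q ]of adj G ∩ C
    restrict {p} {q} agree x∈ with to ∩⇔× x∈
    ... | x∈N , x∈C =
      from ∩⇔× (from (∈N[]⇔ G q) (trans (sym (agree _ x∈C)) (to (∈N[]⇔ G p) x∈N)) , x∈C)

  ∈∉⇒≢ : ∀ {x w} → x ∈ C → w ∉ C → x ≢ w
  ∈∉⇒≢ x∈C w∉C refl = w∉C x∈C

  soleSeparator⇒∈ : ∀ {w} → SoleSeparator G w → w ∈ C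
  soleSeparator⇒∈ {w} (p , q , p≢q , agree) = decidable-stable (w ∈? C) λ w∉C →
    p≢q (identifies (λ x x∈C → agree x (∈∉⇒≢ x∈C w∉C)))

  soleNeighbour⇒∈ : ∀ {w} → SoleNeighbour G w → w ∈ C
  soleNeighbour⇒∈ (v , sole) with proj₂ code v
  ... | y , v~y , y∈C = subst (_∈ C) (sole y v~y) y∈C

  pinned-∉-unique : ∀ {R w₁ w₂} → Pinned G R w₁ → Pinned G R w₂ → w₁ ∉ C → w₂ ∉ C → w₁ ≡ w₂
  pinned-∉-unique {R} {w₁} {w₂} (p₁ , agree₁ , kind₁) (p₂ , agree₂ , kind₂) w₁∉C w₂∉C =
    decidable-stable (w₁ ≟ w₂) λ w₁≢w₂ →
      witnesses-distinct w₁≢w₂ kind₁ kind₂ (identifies λ x x∈C →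
        trans (agree₁ x (∈∉⇒≢ x∈C w₁∉C)) (sym (agree₂ x (∈∉⇒≢ x∈C w₂∉C))))
    where
    witnesses-distinct : w₁ ≢ w₂ → Nbr G p₁ w₁ ≡ not (R w₁) ⊎ p₁ ≡ w₁ →
                         Nbr G p₂ w₂ ≡ not (R w₂) ⊎ p₂ ≡ w₂ → p₁ ≢ p₂
    witnesses-distinct w₁≢w₂ (inj₁ toggled₁) _ refl = not-¬ (agree₂ w₁ w₁≢w₂) toggled₁
    witnesses-distinct w₁≢w₂ (inj₂ _) (inj₁ toggled₂) refl = not-¬ (agree₁ w₂ (w₁≢w₂ ∘ sym)) toggled₂
    witnesses-distinct w₁≢w₂ (inj₂ refl) (inj₂ refl) refl = w₁≢w₂ refl

  tdid-lower-bound : (R : Fin (order G) → Bool) →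
                     (∀ w → SoleSeparator G w ⊎ SoleNeighbour G w ⊎ Pinned G R w) →
                     order G ∸ 1 ≤ ∣ C ∣
  tdid-lower-bound R classify = ∉-unique⇒n∸1≤∣p∣ C λ x∉C y∉C →
    pinned-∉-unique (pinned x∉C) (pinned y∉C) x∉C y∉C
    where
    pinned : ∀ {w} → w ∉ C → Pinned G R w
    pinned {w} w∉C with classify w
    ... | inj₁ separator = contradiction (soleSeparator⇒∈ separator) w∉C
    ... | inj₂ (inj₁ neighbour) = contradiction (soleNeighbour⇒∈ neighbour) w∉C
    ... | inj₂ (inj₂ pinned-w) = pinned-w

record NbrEmbedding (G T : Graph) (RG : Fin (order G) → Bool) (RT : Fin (order T) → Bool) : Set where
  field
    embed           : Fin (order G) → Fin (order T)
    embed-injective : Injective _≡_ _≡_ embed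
    Nbr-embed       : ∀ v y → Nbr T (embed v) (embed y) ≡ Nbr G v y
    R-embed         : ∀ y → RT (embed y) ≡ RG y
    Nbr-outside     : ∀ x → (∃ λ y → embed y ≡ x) ⊎ (∀ v → Nbr T (embed v) x ≡ RT x)

  soleSeparator-embed : ∀ {w} → SoleSeparator G w → SoleSeparator T (embed w)
  soleSeparator-embed {w} (p , q , p≢q , agree) = embed p , embed q , p≢q ∘ embed-injective , agree′
    where
    agree′ : AgreeOff (Nbr T (embed p)) (Nbr T (embed q)) (embed w)
    agree′ x x≢w with Nbr-outside x
    ... | inj₁ (y , refl) =
      trans (Nbr-embed p y) (trans (agree y (x≢w ∘ cong embed)) (sym (Nbr-embed q y)))
    ... | inj₂ uniform = trans (uniform p) (sym (uniform q))

  pinned-embed : ∀ {w} → Pinned G RG w → Pinned T RT (embed w)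
  pinned-embed {w} (p , agree , kind) = embed p , agree′ , kind′ kind
    where
    agree′ : AgreeOff (Nbr T (embed p)) RT (embed w)
    agree′ x x≢w with Nbr-outside x
    ... | inj₁ (y , refl) = trans (Nbr-embed p y) (trans (agree y (x≢w ∘ cong embed)) (sym (R-embed y)))
    ... | inj₂ uniform = uniform p
    kind′ : Nbr G p w ≡ not (RG w) ⊎ p ≡ w →
            Nbr T (embed p) (embed w) ≡ not (RT (embed w)) ⊎ embed p ≡ embed w
    kind′ (inj₁ toggled) = inj₁ (trans (Nbr-embed p w) (trans toggled (cong not (sym (R-embed w)))))
    kind′ (inj₂ refl) = inj₂ refl

SeparatorOrPinned : Graph → Set
SeparatorOrPinned G = ∀ w → SoleSeparator G w ⊎ Pinned G (const true) w

data SplitView (a b : ℕ) : Fin (a + b) → Set where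
  left  : (u : Fin a) → SplitView a b (u ↑ˡ b)
  right : (j : Fin b) → SplitView a b (a ↑ʳ j)

splitView : ∀ a b (x : Fin (a + b)) → SplitView a b x
splitView a b x with splitAt a x in eq
... | inj₁ u = subst (SplitView a b) (splitAt⁻¹-↑ˡ eq) (left u)
... | inj₂ j = subst (SplitView a b) (splitAt⁻¹-↑ʳ eq) (right j)

module _ (G H : Graph) where
  private
    a = order G
    b = order H

  Nbr-⋈-ll : ∀ u v → Nbr (G ⋈ H) (u ↑ˡ b) (v ↑ˡ b) ≡ Nbr G u v
  Nbr-⋈-ll u v rewrite =ᶠ-injective (_↑ˡ b) (↑ˡ-injective b _ _) u v
                     | splitAt-↑ˡ a u b | splitAt-↑ˡ a v b = refl

  Nbr-⋈-lr : ∀ u j → Nbr (G ⋈ H) (u ↑ˡ b) (a ↑ʳ j) ≡ true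
  Nbr-⋈-lr u j rewrite splitAt-↑ˡ a u b | splitAt-↑ʳ a b j = ∨-zeroʳ _

  Nbr-⋈-rl : ∀ j u → Nbr (G ⋈ H) (a ↑ʳ j) (u ↑ˡ b) ≡ true
  Nbr-⋈-rl j u rewrite splitAt-↑ˡ a u b | splitAt-↑ʳ a b j = ∨-zeroʳ _

  Nbr-⋈-rr : ∀ i j → Nbr (G ⋈ H) (a ↑ʳ i) (a ↑ʳ j) ≡ Nbr H i j
  Nbr-⋈-rr i j rewrite =ᶠ-injective (a ↑ʳ_) (↑ʳ-injective a _ _) i j
                     | splitAt-↑ʳ a b i | splitAt-↑ʳ a b j = refl

  ⋈-embedˡ : NbrEmbedding G (G ⋈ H) (const true) (const true)
  ⋈-embedˡ = record
    { embed = _↑ˡ b ; embed-injective = ↑ˡ-injective b _ _ ; Nbr-embed = Nbr-⋈-ll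
    ; R-embed = λ _ → refl ; Nbr-outside = outside }
    where
    outside : ∀ x → (∃ λ y → y ↑ˡ b ≡ x) ⊎ (∀ v → Nbr (G ⋈ H) (v ↑ˡ b) x ≡ true)
    outside x with splitView a b x
    ... | left y  = inj₁ (y , refl)
    ... | right j = inj₂ (λ v → Nbr-⋈-lr v j)

  ⋈-embedʳ : NbrEmbedding H (G ⋈ H) (const true) (const true)
  ⋈-embedʳ = record
    { embed = a ↑ʳ_ ; embed-injective = ↑ʳ-injective a _ _ ; Nbr-embed = Nbr-⋈-rr
    ; R-embed = λ _ → refl ; Nbr-outside = outside }
    where
    outside : ∀ x → (∃ λ y → a ↑ʳ y ≡ x) ⊎ (∀ v → Nbr (G ⋈ H) (a ↑ʳ v) x ≡ true)
    outside x with splitView a b x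
    ... | left u  = inj₂ (λ j → Nbr-⋈-rl j u)
    ... | right j = inj₁ (j , refl)

separatorOrPinned-embed : ∀ {G T} (e : NbrEmbedding G T (const true) (const true)) →
  ∀ {w} → SoleSeparator G w ⊎ Pinned G (const true) w →
  SoleSeparator T (NbrEmbedding.embed e w) ⊎ Pinned T (const true) (NbrEmbedding.embed e w)
separatorOrPinned-embed e (inj₁ separator) = inj₁ (NbrEmbedding.soleSeparator-embed e separator)
separatorOrPinned-embed e (inj₂ pinned) = inj₂ (NbrEmbedding.pinned-embed e pinned)

⋈-separatorOrPinned : ∀ {G H} → SeparatorOrPinned G → SeparatorOrPinned H → SeparatorOrPinned (G ⋈ H)
⋈-separatorOrPinned {G} {H} G-sp H-sp x with splitView (order G) (order H) x
... | left u  = separatorOrPinned-embed (⋈-embedˡ G H) (G-sp u)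
... | right j = separatorOrPinned-embed (⋈-embedʳ G H) (H-sp j)

Nbr-K : ∀ m (i j : Fin m) → Nbr (K m) i j ≡ true
Nbr-K m i j = ∨-inverseʳ (i =ᶠ j)

K-separatorOrPinned : ∀ m → SeparatorOrPinned (K m)
K-separatorOrPinned m w = inj₂ (w , (λ x _ → Nbr-K m w x) , inj₂ refl)

∣m-n∣≤o⇔m≤n+o×n≤m+o : ∀ m n o → ∣ m - n ∣ ≤ o ⇔ (m ≤ n + o × n ≤ m + o)
∣m-n∣≤o⇔m≤n+o×n≤m+o zero    n       o = mk⇔ (z≤n ,_) proj₂
∣m-n∣≤o⇔m≤n+o×n≤m+o (suc m) zero    o = mk⇔ (_, z≤n) proj₁
∣m-n∣≤o⇔m≤n+o×n≤m+o (suc m) (suc n) o = mk⇔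
  (λ h → let m≤ , n≤ = to ih h in s≤s m≤ , s≤s n≤)
  (λ { (s≤s m≤ , s≤s n≤) → from ih (m≤ , n≤) })
  where ih = ∣m-n∣≤o⇔m≤n+o×n≤m+o m n o

-- A (suc K) is the K-th power of the path on 2K + 2 vertices.
module PathPower (K : ℕ) where

  near : ℕ → ℕ → Bool
  near a x = ∣ a - x ∣ ≤ᵇ K

  near≡true⇔ : ∀ a x → near a x ≡ true ⇔ (a ≤ x + K × x ≤ a + K)
  near≡true⇔ a x = mk⇔ (to interval ∘ ≤ᵇ⇒≤ _ _ ∘ from T-≡) (to T-≡ ∘ ≤⇒≤ᵇ ∘ from interval)
    where interval = ∣m-n∣≤o⇔m≤n+o×n≤m+o a x K

  near-suc : ∀ {s x} → x + K ≢ s → x ≢ suc (s + K) → near s x ≡ near (suc s) x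
  near-suc {s} {x} x+K≢s x≢ = ⇔→≡ (mk⇔
    (from (near≡true⇔ (suc s) x) ∘ widen ∘ to (near≡true⇔ s x))
    (from (near≡true⇔ s x) ∘ narrow ∘ to (near≡true⇔ (suc s) x)))
    where
    widen : s ≤ x + K × x ≤ s + K → suc s ≤ x + K × x ≤ suc s + K
    widen (s≤ , x≤) = ≤∧≢⇒< s≤ (x+K≢s ∘ sym) , m≤n⇒m≤1+n x≤
    narrow : suc s ≤ x + K × x ≤ suc s + K → s ≤ x + K × x ≤ s + K
    narrow (s< , x≤) = <⇒≤ s< , s≤s⁻¹ (≤∧≢⇒< x≤ x≢)

  B : ℕ
  B = suc (K + K)

  private
    n≡suc-B : suc K + suc K ≡ suc B
    n≡suc-B = cong suc (+-suc K K)

  toℕ≤B : (x : Fin (suc K + suc K)) → toℕ x ≤ B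
  toℕ≤B x = s≤s⁻¹ (subst (toℕ x <_) n≡suc-B (toℕ<n x))

  vertex : ∀ {p} → p ≤ B → Fin (suc K + suc K)
  vertex {p} p≤B = fromℕ< (subst (p <_) (sym n≡suc-B) (s≤s p≤B))

  Nbr-A : ∀ i x → Nbr (A (suc K)) i x ≡ near (toℕ i) (toℕ x)
  Nbr-A i x with i =ᶠ x in i=x
  ... | true rewrite ≡ᵇ⇒≡ (toℕ i) (toℕ x) (from T-≡ i=x) | ∣n-n∣≡0 (toℕ x) = refl
  ... | false = refl

  toℕ-vertex : ∀ {p} (p≤B : p ≤ B) → toℕ (vertex p≤B) ≡ p
  toℕ-vertex {p} _ = toℕ-fromℕ< {m = p} {n = suc K + suc K} _

  Nbr-vertex : ∀ {p} (p≤B : p ≤ B) x → Nbr (A (suc K)) (vertex p≤B) x ≡ near p (toℕ x)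
  Nbr-vertex p≤B x = trans (Nbr-A (vertex p≤B) x) (cong (λ a → near a (toℕ x)) (toℕ-vertex p≤B))

  consecutive-soleSeparator : ∀ {w t} → toℕ w ≡ t → ∀ s → suc s ≤ B →
    (∀ x → x ≤ B → x ≢ t → x + K ≢ s × x ≢ suc (s + K)) → SoleSeparator (A (suc K)) w
  consecutive-soleSeparator {w} w≡t s s<B only-t = vertex s≤B , vertex s<B , p≢q , agree
    where
    s≤B = ≤-trans (n≤1+n s) s<B
    p≢q : vertex s≤B ≢ vertex s<B
    p≢q e = <⇒≢ (n<1+n s) (trans (sym (toℕ-vertex s≤B)) (trans (cong toℕ e) (toℕ-vertex s<B)))
    agree : AgreeOff (Nbr (A (suc K)) (vertex s≤B)) (Nbr (A (suc K)) (vertex s<B)) w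
    agree x x≢w with only-t (toℕ x) (toℕ≤B x) (λ e → x≢w (toℕ-injective (trans e (sym w≡t))))
    ... | x+K≢s , x≢ = begin
      Nbr (A (suc K)) (vertex s≤B) x ≡⟨ Nbr-vertex s≤B x ⟩
      near s (toℕ x)                 ≡⟨ near-suc x+K≢s x≢ ⟩
      near (suc s) (toℕ x)           ≡⟨ Nbr-vertex s<B x ⟨
      Nbr (A (suc K)) (vertex s<B) x ∎
      where open ≡-Reasoning

  pinned-by : ∀ {w t} → toℕ w ≡ t → ∀ p (p≤B : p ≤ B) →
    ¬ (p ≤ t + K × t ≤ p + K) → (∀ x → x ≤ B → x ≢ t → p ≤ x + K × x ≤ p + K) →
    Pinned (A (suc K)) (const true) w
  pinned-by {w} refl p p≤B far close = vertex p≤B , agree , inj₁ toggled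
    where
    agree : AgreeOff (Nbr (A (suc K)) (vertex p≤B)) (const true) w
    agree x x≢w = trans (Nbr-vertex p≤B x)
      (from (near≡true⇔ p (toℕ x)) (close (toℕ x) (toℕ≤B x) (x≢w ∘ toℕ-injective)))
    toggled : Nbr (A (suc K)) (vertex p≤B) w ≡ false
    toggled = trans (Nbr-vertex p≤B w) (¬-not (far ∘ to (near≡true⇔ p (toℕ w))))

  data Position : ℕ → Set where
    first : Position 0
    lower : ∀ {t} → t < K → Position (suc t)
    upper : ∀ {s} → s < K → Position (suc (s + K))
    last  : Position B

  position : ∀ t → t ≤ B → Position t
  position zero _ = first
  position (suc t) t<B with t <? K
  ... | yes t<K = lower t<K
  ... | no t≮K with t ∸ K <? K
  ...   | yes s<K = subst (Position ∘ suc) (m∸n+n≡m (≮⇒≥ t≮K)) (upper s<K)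
  ...   | no s≮K = subst (Position ∘ suc) (≤-antisym K+K≤t (s≤s⁻¹ t<B)) last
    where
    K+K≤t : K + K ≤ t
    K+K≤t = ≤-trans (+-monoˡ-≤ K (≮⇒≥ s≮K)) (≤-reflexive (m∸n+n≡m (≮⇒≥ t≮K)))

  -- 0 and B are pinned by suc K and K; a lower t is the sole separator of t + K and
  -- t + K + 1, an upper t = s + K + 1 that of s and s + 1.
  separatorOrPinned : ∀ {w t} → toℕ w ≡ t → Position t →
                      SoleSeparator (A (suc K)) w ⊎ Pinned (A (suc K)) (const true) w
  separatorOrPinned w≡0 first = inj₂ (pinned-by w≡0 (suc K) (s≤s (m≤m+n K K)) far close)
    where
    far : ¬ (suc K ≤ 0 + K × 0 ≤ suc K + K)
    far (K<K , _) = 1+n≰n K<K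
    close : ∀ x → x ≤ B → x ≢ 0 → suc K ≤ x + K × x ≤ suc K + K
    close zero    _   x≢0 = contradiction refl x≢0
    close (suc x) x≤B _   = s≤s (m≤n+m K x) , x≤B
  separatorOrPinned w≡t (lower {t} t<K) =
    inj₁ (consecutive-soleSeparator w≡t (suc t + K) (s≤s (+-monoˡ-≤ K t<K)) only-t)
    where
    B<s+K : B < suc (suc (t + K) + K)
    B<s+K = s≤s (s≤s (+-monoˡ-≤ K (m≤n+m K t)))
    only-t : ∀ x → x ≤ B → x ≢ suc t → x + K ≢ suc t + K × x ≢ suc (suc t + K + K)
    only-t x x≤B x≢t = x≢t ∘ +-cancelʳ-≡ K x (suc t) , <⇒≢ (≤-<-trans x≤B B<s+K)
  separatorOrPinned w≡t (upper {s} s<K) =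
    inj₁ (consecutive-soleSeparator w≡t s (≤-trans s<K (m≤n⇒m≤1+n (m≤m+n K K))) only-t)
    where
    only-t : ∀ x → x ≤ B → x ≢ suc (s + K) → x + K ≢ s × x ≢ suc (s + K)
    only-t x _ x≢t = (λ e → <⇒≢ (<-≤-trans s<K (m≤n+m K x)) (sym e)) , x≢t
  separatorOrPinned w≡B last = inj₂ (pinned-by w≡B K (m≤n⇒m≤1+n (m≤m+n K K)) far close)
    where
    far : ¬ (K ≤ B + K × B ≤ K + K)
    far (_ , B≤K+K) = 1+n≰n B≤K+K
    close : ∀ x → x ≤ B → x ≢ B → K ≤ x + K × x ≤ K + K
    close x x≤B x≢B = m≤n+m K x , s≤s⁻¹ (≤∧≢⇒< x≤B x≢B)

A-separatorOrPinned : ∀ k → 1 ≤ k → SeparatorOrPinned (A k)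
A-separatorOrPinned (suc K) _ w = separatorOrPinned refl (position (toℕ w) (toℕ≤B w))
  where open PathPower K

joinA-separatorOrPinned : ∀ ks → All (1 ≤_) ks → SeparatorOrPinned (joinA ks)
joinA-separatorOrPinned []       []           ()
joinA-separatorOrPinned (k ∷ ks) (1≤k ∷ 1≤ks) =
  ⋈-separatorOrPinned (A-separatorOrPinned k 1≤k) (joinA-separatorOrPinned ks 1≤ks)

G''-separatorOrPinned : ∀ ks → All (1 ≤_) ks → ∀ b → SeparatorOrPinned (G'' ks b)
G''-separatorOrPinned ks 1≤ks true  = ⋈-separatorOrPinned (joinA-separatorOrPinned ks 1≤ks) (K-separatorOrPinned 1)
G''-separatorOrPinned ks 1≤ks false = joinA-separatorOrPinned ks 1≤ks

module LeafAttachment (g : Graph) (m : ℕ) where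

  private
    p = order g
    G′ = g ⋈ K m

  T : Graph
  T = attachLeaves p m (adj G′)

  nonLeaf : Fin (order T) → Bool
  nonLeaf = [ const true , const false ] ∘ splitAt (p + m)

  leaf : Fin m → Fin (order T)
  leaf j = (p + m) ↑ʳ j

  nonLeaf-↑ˡ : ∀ u → nonLeaf (u ↑ˡ m) ≡ true
  nonLeaf-↑ˡ u rewrite splitAt-↑ˡ (p + m) u m = refl

  nonLeaf-leaf : ∀ j → nonLeaf (leaf j) ≡ false
  nonLeaf-leaf j rewrite splitAt-↑ʳ (p + m) m j = refl

  Nbr-T-↑ˡ : ∀ u v → Nbr T (u ↑ˡ m) (v ↑ˡ m) ≡ Nbr G′ u v
  Nbr-T-↑ˡ u v rewrite =ᶠ-injective (_↑ˡ m) (↑ˡ-injective m _ _) u v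
                     | splitAt-↑ˡ (p + m) u m | splitAt-↑ˡ (p + m) v m = refl

  adj-T-leaf : ∀ j u → adj T (leaf j) (u ↑ˡ m) ≡ (u =ᶠ (p ↑ʳ j))
  adj-T-leaf j u rewrite splitAt-↑ˡ (p + m) u m | splitAt-↑ʳ (p + m) m j | toℕ-↑ʳ p j = refl

  adj-T-leaf-leaf : ∀ i j → adj T (leaf i) (leaf j) ≡ false
  adj-T-leaf-leaf i j rewrite splitAt-↑ʳ (p + m) m i | splitAt-↑ʳ (p + m) m j = refl

  Nbr-T-↑ˡ-leaf : ∀ u j → Nbr T (u ↑ˡ m) (leaf j) ≡ (u =ᶠ (p ↑ʳ j))
  Nbr-T-↑ˡ-leaf u j rewrite =ᶠ-≢ (↑ˡ≢↑ʳ u j)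
                          | splitAt-↑ˡ (p + m) u m | splitAt-↑ʳ (p + m) m j | toℕ-↑ʳ p j = refl

  clique-universal : ∀ c u → Nbr G′ (p ↑ʳ c) u ≡ true
  clique-universal c u with splitView p m u
  ... | left v   = Nbr-⋈-rl g (K m) c v
  ... | right c′ = trans (Nbr-⋈-rr g (K m) c c′) (Nbr-K m c c′)

  embedding : NbrEmbedding g T (const true) nonLeaf
  embedding = record
    { embed = λ v → (v ↑ˡ m) ↑ˡ m
    ; embed-injective = ↑ˡ-injective m _ _ ∘ ↑ˡ-injective m _ _
    ; Nbr-embed = λ v y → trans (Nbr-T-↑ˡ (v ↑ˡ m) (y ↑ˡ m)) (Nbr-⋈-ll g (K m) v y)
    ; R-embed = λ v → nonLeaf-↑ˡ (v ↑ˡ m)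
    ; Nbr-outside = outside }
    where
    outside : ∀ x → (∃ λ y → (y ↑ˡ m) ↑ˡ m ≡ x) ⊎ (∀ v → Nbr T ((v ↑ˡ m) ↑ˡ m) x ≡ nonLeaf x)
    outside x with splitView (p + m) m x
    ... | right j = inj₂ λ v →
      trans (Nbr-T-↑ˡ-leaf (v ↑ˡ m) j) (trans (=ᶠ-≢ (↑ˡ≢↑ʳ v j)) (sym (nonLeaf-leaf j)))
    ... | left u with splitView p m u
    ...   | left y  = inj₁ (y , refl)
    ...   | right c = inj₂ λ v →
      trans (Nbr-T-↑ˡ (v ↑ˡ m) (p ↑ʳ c)) (trans (Nbr-⋈-lr g (K m) v c) (sym (nonLeaf-↑ˡ _)))

  leaf-soleNeighbour : ∀ c → SoleNeighbour T ((p ↑ʳ c) ↑ˡ m)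
  leaf-soleNeighbour c = leaf c , sole
    where
    sole : ∀ y → adj T (leaf c) y ≡ true → y ≡ (p ↑ʳ c) ↑ˡ m
    sole y leaf~y with splitView (p + m) m y
    ... | left u  = cong (_↑ˡ m) (to =ᶠ⇔≡ (trans (sym (adj-T-leaf c u)) leaf~y))
    ... | right k = contradiction (trans (sym (adj-T-leaf-leaf c k)) leaf~y) λ ()

  leaf-pinned : ∀ j → Pinned T nonLeaf (leaf j)
  leaf-pinned j = (p ↑ʳ j) ↑ˡ m , agree , inj₁ toggled
    where
    agree : AgreeOff (Nbr T ((p ↑ʳ j) ↑ˡ m)) nonLeaf (leaf j)
    agree x x≢leaf with splitView (p + m) m x
    ... | left u  = trans (Nbr-T-↑ˡ (p ↑ʳ j) u) (trans (clique-universal j u) (sym (nonLeaf-↑ˡ u)))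
    ... | right k = begin
      Nbr T ((p ↑ʳ j) ↑ˡ m) (leaf k) ≡⟨ Nbr-T-↑ˡ-leaf (p ↑ʳ j) k ⟩
      ((p ↑ʳ j) =ᶠ (p ↑ʳ k))         ≡⟨ =ᶠ-injective (p ↑ʳ_) (↑ʳ-injective p _ _) j k ⟩
      (j =ᶠ k)                       ≡⟨ =ᶠ-≢ (λ j≡k → x≢leaf (cong leaf (sym j≡k))) ⟩
      false                          ≡⟨ nonLeaf-leaf k ⟨
      nonLeaf (leaf k)               ∎
      where open ≡-Reasoning
    toggled : Nbr T ((p ↑ʳ j) ↑ˡ m) (leaf j) ≡ not (nonLeaf (leaf j))
    toggled = trans (Nbr-T-↑ˡ-leaf (p ↑ʳ j) j) (trans (=ᶠ-refl (p ↑ʳ j)) (cong not (sym (nonLeaf-leaf j))))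

  classify : SeparatorOrPinned g → ∀ w → SoleSeparator T w ⊎ SoleNeighbour T w ⊎ Pinned T nonLeaf w
  classify g-sp w with splitView (p + m) m w
  ... | right j = inj₂ (inj₂ (leaf-pinned j))
  ... | left u with splitView p m u
  ...   | right c = inj₂ (inj₁ (leaf-soleNeighbour c))
  ...   | left v with g-sp v
  ...     | inj₁ separator = inj₁ (NbrEmbedding.soleSeparator-embed embedding separator)
  ...     | inj₂ pinned    = inj₂ (inj₂ (NbrEmbedding.pinned-embed embedding pinned))

-- The bound holds without the hypotheses m ≥ 1 and n ≥ 3.
proposition6 : (m : ℕ) → 1 ≤ m → (ks : List ℕ) → All (1 ≤_) ks → (b : Bool)
    → 3 ≤ order (theGraph m ks b)
    → (C : Subset (order (theGraph m ks b))) → IsTDIDCode (theGraph m ks b) C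
    → order (theGraph m ks b) ∸ 1 ≤ ∣ C ∣
proposition6 m _ ks 1≤ks b _ C code =
  tdid-lower-bound code nonLeaf (classify (G''-separatorOrPinned ks 1≤ks b))
  where open LeafAttachment (G'' ks b) m
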